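{- Let $A,B,C$ be sets, let $(S,\gamma_S)$ be a $\mathbb{T}_A$-residual $\mathbb{T}_B$-comodel and $(P,\gamma_P)$ a $\mathbb{T}_B$-residual $\mathbb{T}_C$-comodel. Then for all $s\in S$ and $p\in P$, the trace of the state $(p,s)$ of the tensor product $P\cdot S$ satisfies $\mathsf{tr}^{P\cdot S}(p,s)=\mathsf{tr}^{P}(p)\circ \mathsf{tr}^{S}(s)\colon A^{\mathbb{N}}\to C^{\mathbb{N}}$.
   Context: For a set $A$, $\mathbb{T}_A$ is the theory with a single $A$-ary operation $\mathsf{read}$ and no equations; $T_A(V)$ is the set of well-founded $A$-ary branching trees whose leaves are labelled by elements of $V$ (a leaf $v$, or $\mathsf{read}(\lambda a.\,t_a)$ with $t\in T_A(V)^A$). For $t\in T_A(V)$ and $u\colon V\to T_A(W)$, $t(u)\in T_A(W)$ denotes substitution of $u_v$ for each leaf $v$. A $\mathbb{T}_A$-residual $\mathbb{T}_B$-comodel is a set $S$ with a function $\gamma_S\colon S\to T_A(B\times S)$. For $t\in T_B(V)$ define $[\![t]\!]^{S}\colon S\to T_A(V\times S)$ recursively by $[\![v]\!]^S(s)=(v,s)$ (a leaf) and $[\![\mathsf{read}(\lambda b.\,t_b)]\!]^S(s)=\gamma_S(s)\bigl(\lambda(b,s').\,[\![t_b]\!]^S(s')\bigr)$. The tensor product $P\cdot S$ is the $\mathbb{T}_A$-residual $\mathbb{T}_C$-comodel with state set $P\times S$ and structure map $(p,s)\mapsto [\![\gamma_P(p)]\!]^S(s)\in T_A(C\times P\times S)$.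 Write $\partial$ for the shift $(a_0,a_1,\dots)\mapsto(a_1,a_2,\dots)$ on $A^{\mathbb{N}}$. For $t\in T_A(V)$ define $\langle t\rangle\colon A^{\mathbb{N}}\to V\times A^{\mathbb{N}}$ by $\langle v\rangle(\vec a)=(v,\vec a)$ and $\langle \mathsf{read}(\lambda a.\,t_a)\rangle(\vec a)=\langle t_{a_0}\rangle(\partial\vec a)$. For a $\mathbb{T}_A$-residual $\mathbb{T}_B$-comodel $(S,\gamma)$ write $\langle\gamma(s)\rangle(\vec a)=(\mathsf{hd}(s,\vec a),\mathsf{next}(s,\vec a),\mathsf{tl}(s,\vec a))\in B\times S\times A^{\mathbb{N}}$; the trace $\mathsf{tr}(s)\colon A^{\mathbb{N}}\to B^{\mathbb{N}}$ of $s\in S$ is defined coinductively by $(\mathsf{tr}(s)(\vec a))_0=\mathsf{hd}(s,\vec a)$ and $\partial(\mathsf{tr}(s)(\vec a))=\mathsf{tr}(\mathsf{next}(s,\vec a))(\mathsf{tl}(s,\vec a))$. -}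

module Defs where

open import Data.Nat using (ℕ; zero; suc)
open import Data.Product using (_×_; _,_; proj₁; proj₂)

data Tree (A : Set) (V : Set) : Set where
  leaf : V → Tree A V
  read : (A → Tree A V) → Tree A V

subst : {A V W : Set} → Tree A V → (V → Tree A W) → Tree A W
subst (leaf v) u = u v
subst (read f) u = read (λ a → subst (f a) u)

-- T_A-residual T_B-comodel: a state set with a structure map
record Comodel (A B : Set) : Set₁ where
  field
    State : Set
    γ     : State → Tree A (B × State)
open Comodel public

⟦_⟧ : {A B V : Set} → Tree B V → (S : Comodel A B) → State S → Tree A (V × State S)
⟦ leaf v ⟧ S s = leaf (v , s)
⟦ read f ⟧ S s = subst (γ S s) (λ { (b , s′) → ⟦ f b ⟧ S s′ })

_·_ : {A B C : Set} → Comodel B C → Comodel A B → Comodel A C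
State (P · S) = State P × State S
γ (P · S) (p , s) = subst (⟦ γ P p ⟧ S s) (λ x → leaf (proj₁ (proj₁ x) , (proj₂ (proj₁ x) , proj₂ x)))
  -- the leaf ((c , p′) , s′) is read as (c , (p′ , s′)) ∈ C × (P × S)

Stream : Set → Set
Stream A = ℕ → A

∂ : {A : Set} → Stream A → Stream A
∂ as n = as (suc n)

⟨_⟩ : {A V : Set} → Tree A V → Stream A → V × Stream A
⟨ leaf v ⟩ as = v , as
⟨ read f ⟩ as = ⟨ f (as 0) ⟩ (∂ as)

module _ {A B : Set} (S : Comodel A B) where
  hd : State S → Stream A → B
  hd s as = proj₁ (proj₁ (⟨ γ S s ⟩ as))

  next : State S → Stream A → State S
  next s as = proj₂ (proj₁ (⟨ γ S s ⟩ as))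

  tl : State S → Stream A → Stream A
  tl s as = proj₂ (⟨ γ S s ⟩ as)

  tr : State S → Stream A → Stream B
  tr s as zero    = hd s as
  tr s as (suc n) = tr (next s as) (tl s as) n

{-# OPTIONS --safe #-}
module Submission where

-- Running a B-tree t on the trace of s consumes exactly the B-symbols that S emits
-- while ⟦ t ⟧ runs on the A-input, so both runs end with the same leaf, and what is
-- left of the trace is the trace of the state and input left over. Applied to the
-- tree γ P p, this matches one step of P · S with one step of P fed by tr S s, and
-- induction on the position in the output stream finishes the proof.

open import Defs
open import Data.Nat using (ℕ; zero; suc)
open import Data.Product using (_×_; _,_; proj₁; proj₂)
open import Function using (_∘_)
open import Relation.Binary.PropositionalEquality using (_≡_; refl; sym; cong; module ≡-Reasoning)

run-subst : {A V W : Set} (t : Tree A V) (u : V → Tree A W) (as : Stream A) →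
  ⟨ subst t u ⟩ as ≡ ⟨ u (proj₁ (⟨ t ⟩ as)) ⟩ (proj₂ (⟨ t ⟩ as))
run-subst (leaf v) u as = refl
run-subst (read f) u as = run-subst (f (as 0)) u (∂ as)

module _ {A B : Set} (S : Comodel A B) where

  traced : {V : Set} → (V × State S) × Stream A → V × Stream B
  traced ((v , s) , as) = v , tr S s as

  -- The read case starts from ⟨ f (hd S s as) ⟩ (tr S (next S s as) (tl S s as)), since
  -- ∂ (tr S s as) is definitionally tr S (next S s as) (tl S s as).
  run-trace : {V : Set} (t : Tree B V) (s : State S) (as : Stream A) →
    ⟨ t ⟩ (tr S s as) ≡ traced (⟨ ⟦ t ⟧ S s ⟩ as)
  run-trace (leaf v) s as = refl
  run-trace (read f) s as = begin
    ⟨ f (hd S s as) ⟩ (tr S (next S s as) (tl S s as))          ≡⟨ run-trace (f (hd S s as)) (next S s as) (tl S s as) ⟩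
    traced (⟨ ⟦ f (hd S s as) ⟧ S (next S s as) ⟩ (tl S s as))  ≡⟨ cong traced (sym (run-subst (γ S s) _ as)) ⟩
    traced (⟨ ⟦ read f ⟧ S s ⟩ as)                              ∎
    where open ≡-Reasoning

reassociate : {C P S A : Set} → ((C × P) × S) × Stream A → (C × (P × S)) × Stream A
reassociate (((c , p) , s) , as) = (c , (p , s)) , as

run-tensor : {A B C : Set} (S : Comodel A B) (P : Comodel B C) (p : State P) (s : State S)
  (as : Stream A) → ⟨ γ (P · S) (p , s) ⟩ as ≡ reassociate (⟨ ⟦ γ P p ⟧ S s ⟩ as)
run-tensor S P p s as = run-subst (⟦ γ P p ⟧ S s) _ as

proposition3p9 : {A B C : Set} (S : Comodel A B) (P : Comodel B C)
    (s : State S) (p : State P) (as : Stream A) (n : ℕ) →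
    tr (P · S) (p , s) as n ≡ tr P p (tr S s as) n
proposition3p9 S P s p as zero = begin
    hd (P · S) (p , s) as                          ≡⟨ cong (proj₁ ∘ proj₁) (run-tensor S P p s as) ⟩
    proj₁ (proj₁ (proj₁ (⟨ ⟦ γ P p ⟧ S s ⟩ as)))  ≡⟨ cong (proj₁ ∘ proj₁) (sym (run-trace S (γ P p) s as)) ⟩
    hd P p (tr S s as)                             ∎
  where open ≡-Reasoning
proposition3p9 S P s p as (suc n) = begin
    tr (P · S) (next (P · S) (p , s) as) (tl (P · S) (p , s) as) n  ≡⟨ cong (remaining-trace (P · S)) (run-tensor S P p s as) ⟩
    tr (P · S) (p′ , s′) as′ n                                       ≡⟨ proposition3p9 S P s′ p′ as′ n ⟩
    tr P p′ (tr S s′ as′) n                                          ≡⟨ cong (remaining-trace P) (sym (run-trace S (γ P p) s as)) ⟩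
    tr P (next P p (tr S s as)) (tl P p (tr S s as)) n               ∎
  where
    open ≡-Reasoning
    p′ : State P
    p′ = proj₂ (proj₁ (proj₁ (⟨ ⟦ γ P p ⟧ S s ⟩ as)))
    s′ : State S
    s′ = proj₂ (proj₁ (⟨ ⟦ γ P p ⟧ S s ⟩ as))
    as′ : Stream _
    as′ = proj₂ (⟨ ⟦ γ P p ⟧ S s ⟩ as)

    remaining-trace : {D E : Set} (R : Comodel D E) → (E × State R) × Stream D → E
    remaining-trace R ((_ , r) , ds) = tr R r ds n
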